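{- In any topological space, every $\omega$-constructible set can be written as a disjoint countable union of locally closed sets.
   Context: A subset of a topological space is locally closed if it is the intersection of an open set and a closed set. A set is $\omega$-constructible if it is a countable union of locally closed sets. -}

module Defs where

open import Data.Nat using (ℕ)
open import Data.Product using (Σ; ∃; _×_; _,_)
open import Data.Empty using (⊥)
open import Relation.Nullary using (¬_)
open import Relation.Binary.PropositionalEquality using (_≢_)
open import Function.Bundles using (_⇔_)

record Topology (X : Set) : Set₁ where
  field
    Open       : (X → Set) → Set
    Open-resp  : ∀ {U V : X → Set} → (∀ x → U x ⇔ V x) → Open U → Open V
    Open-univ  : Open (λ _ → X)
    Open-⋃     : ∀ (I : Set) (U : I → X → Set) →
                 (∀ i → Open (U i)) → Open (λ x → ∃ λ i → U i x)
    Open-∩     : ∀ {U V : X → Set} → Open U → Open V → Open (λ x → U x × V x)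

module _ {X : Set} (τ : Topology X) where
  open Topology τ

  Closed : (X → Set) → Set
  Closed F = Open (λ x → ¬ F x)

  LocallyClosed : (X → Set) → Set₁
  LocallyClosed A = Σ (X → Set) λ U → Σ (X → Set) λ F →
    Open U × Closed F × (∀ x → A x ⇔ (U x × F x))

  ωConstructible : (X → Set) → Set₁
  ωConstructible A = Σ (ℕ → X → Set) λ B →
    (∀ n → LocallyClosed (B n)) × (∀ x → A x ⇔ (∃ λ n → B n x))

  DisjointUnionOfLocallyClosed : (X → Set) → Set₁
  DisjointUnionOfLocallyClosed A = Σ (ℕ → X → Set) λ B →
    (∀ n → LocallyClosed (B n)) ×
    (∀ m n → m ≢ n → ∀ x → B m x → B n x → ⊥) ×
    (∀ x → A x ⇔ (∃ λ n → B n x))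

module Submission where

-- If B₀, B₁, … are locally closed, then ⋃ Bₙ is the disjoint union of the
-- sets Bₙ ∖ (B₀ ∪ … ∪ Bₙ₋₁).  The complement of a locally closed set U ∩ F
-- is the disjoint union of the two locally closed sets X ∖ F and F ∖ U, so
-- Bₙ ∖ (B₀ ∪ … ∪ Bₙ₋₁) splits into the 2ⁿ disjoint locally closed sets
-- C₀ ∩ … ∩ Cₙ₋₁ ∩ Bₙ, where each Cₖ is one of the two pieces of X ∖ Bₖ.
-- Over all n these pieces are indexed by finite bit strings, i.e. countably.

open import Defs
open import Level using (0ℓ)
open import Axiom.ExcludedMiddle using (ExcludedMiddle)
open import Data.Nat using (ℕ; zero; suc; _+_)
open import Data.Nat.Properties using (+-suc; +-identityʳ)
open import Data.Nat.Binary.Base using (ℕᵇ; 2[1+_]; 1+[2_]; fromℕ; toℕ)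
  renaming (zero to ε)
open import Data.Nat.Binary.Properties using (fromℕ-injective; fromℕ-toℕ)
open import Data.Product using (∃; _×_; _,_; proj₁; proj₂)
open import Data.Sum using (_⊎_; inj₁; inj₂)
open import Data.Bool using (Bool; true; false)
open import Data.Unit using (⊤; tt)
open import Data.Empty using (⊥; ⊥-elim)
open import Relation.Nullary using (¬_; yes; no)
open import Relation.Binary.PropositionalEquality using (_≢_; refl; cong; subst; sym)
open import Function using (_∘_)
open import Function.Bundles using (_⇔_; mk⇔; Equivalence)
open import Function.Properties.Equivalence using (trans)

open Equivalence using (to; from)

module Disjointification {X : Set} (B : ℕ → X → Set) (C : ℕ → Bool → X → Set) where

  Piece : ℕ → ℕᵇ → X → Set
  Piece k ε        x = B k x
  Piece k 2[1+ w ] x = C k true x × Piece (suc k) w x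
  Piece k 1+[2 w ] x = C k false x × Piece (suc k) w x

  Piece-closure : (P : (X → Set) → Set₁) →
    (∀ {D E} → P D → P E → P (λ x → D x × E x)) →
    (∀ k → P (B k)) → (∀ k b → P (C k b)) →
    ∀ k w → P (Piece k w)
  Piece-closure P P-∩ P-B P-C k ε        = P-B k
  Piece-closure P P-∩ P-B P-C k 2[1+ w ] = P-∩ (P-C k true) (Piece-closure P P-∩ P-B P-C (suc k) w)
  Piece-closure P P-∩ P-B P-C k 1+[2 w ] = P-∩ (P-C k false) (Piece-closure P P-∩ P-B P-C (suc k) w)

  Piece-disjoint : (∀ k b x → C k b x → B k x → ⊥) →
    (∀ k x → C k true x → C k false x → ⊥) →
    ∀ k {v w} → v ≢ w → ∀ x → Piece k v x → Piece k w x → ⊥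
  Piece-disjoint C∩B C∩C k {ε}        {ε}        v≢w x _        _        = v≢w refl
  Piece-disjoint C∩B C∩C k {ε}        {2[1+ _ ]} _   x p        (c , _)  = C∩B k true x c p
  Piece-disjoint C∩B C∩C k {ε}        {1+[2 _ ]} _   x p        (c , _)  = C∩B k false x c p
  Piece-disjoint C∩B C∩C k {2[1+ _ ]} {ε}        _   x (c , _)  p        = C∩B k true x c p
  Piece-disjoint C∩B C∩C k {1+[2 _ ]} {ε}        _   x (c , _)  p        = C∩B k false x c p
  Piece-disjoint C∩B C∩C k {2[1+ _ ]} {1+[2 _ ]} _   x (c , _)  (c′ , _) = C∩C k x c c′
  Piece-disjoint C∩B C∩C k {1+[2 _ ]} {2[1+ _ ]} _   x (c′ , _) (c , _)  = C∩C k x c c′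
  Piece-disjoint C∩B C∩C k {2[1+ _ ]} {2[1+ _ ]} v≢w x (_ , p) (_ , q) =
    Piece-disjoint C∩B C∩C (suc k) (v≢w ∘ cong 2[1+_]) x p q
  Piece-disjoint C∩B C∩C k {1+[2 _ ]} {1+[2 _ ]} v≢w x (_ , p) (_ , q) =
    Piece-disjoint C∩B C∩C (suc k) (v≢w ∘ cong 1+[2_]) x p q

  Piece⇒⋃B : ∀ k w x → Piece k w x → ∃ λ n → B n x
  Piece⇒⋃B k ε        x p       = k , p
  Piece⇒⋃B k 2[1+ w ] x (_ , p) = Piece⇒⋃B (suc k) w x p
  Piece⇒⋃B k 1+[2 w ] x (_ , p) = Piece⇒⋃B (suc k) w x p

  B⇒Piece : (∀ k x → B k x ⊎ ∃ λ b → C k b x) →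
    ∀ n k x → B (n + k) x → ∃ λ w → Piece k w x
  B⇒Piece B⊎C zero    k x b = ε , b
  B⇒Piece B⊎C (suc n) k x b
    with B⊎C k x | B⇒Piece B⊎C n (suc k) x (subst (λ m → B m x) (sym (+-suc n k)) b)
  ... | inj₁ bₖ          | _     = ε , bₖ
  ... | inj₂ (true  , c) | w , p = 2[1+ w ] , c , p
  ... | inj₂ (false , c) | w , p = 1+[2 w ] , c , p

  ⋃B⇔⋃Piece : (∀ k x → B k x ⊎ ∃ λ b → C k b x) →
    ∀ x → (∃ λ n → B n x) ⇔ (∃ λ m → Piece 0 (fromℕ m) x)
  ⋃B⇔⋃Piece B⊎C x = mk⇔ from⋃B (λ (m , p) → Piece⇒⋃B 0 (fromℕ m) x p)
    where
    from⋃B : (∃ λ n → B n x) → ∃ λ m → Piece 0 (fromℕ m) x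
    from⋃B (n , b) with B⇒Piece B⊎C n 0 x (subst (λ m → B m x) (sym (+-identityʳ n)) b)
    ... | w , p = toℕ w , subst (λ v → Piece 0 v x) (sym (fromℕ-toℕ w)) p

module Topological (em : ExcludedMiddle 0ℓ) {X : Set} (τ : Topology X) where
  open Topology τ

  ¬¬-elim : ∀ {P : Set} → ¬ ¬ P → P
  ¬¬-elim {P} ¬¬p with em {P}
  ... | yes p = p
  ... | no ¬p = ⊥-elim (¬¬p ¬p)

  Open-∅ : Open (λ _ → ⊥)
  Open-∅ = Open-resp (λ _ → mk⇔ (λ ()) ⊥-elim) (Open-⋃ ⊥ (λ ()) (λ ()))

  Closed-univ : Closed τ (λ _ → ⊤)
  Closed-univ = Open-resp (λ _ → mk⇔ ⊥-elim (λ ¬⊤ → ¬⊤ tt)) Open-∅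

  Closed-∩ : ∀ {F G : X → Set} → Closed τ F → Closed τ G → Closed τ (λ x → F x × G x)
  Closed-∩ {F} {G} cF cG =
    Open-resp (λ x → mk⇔ ¬F∪¬G⇒¬F∩G (¬F∩G⇒¬F∪¬G x))
      (Open-⋃ Bool complement (λ { true → cF ; false → cG }))
    where
    complement : Bool → X → Set
    complement true  x = ¬ F x
    complement false x = ¬ G x
    ¬F∪¬G⇒¬F∩G : ∀ {x} → (∃ λ b → complement b x) → ¬ (F x × G x)
    ¬F∪¬G⇒¬F∩G (true  , ¬f) (f , _) = ¬f f
    ¬F∪¬G⇒¬F∩G (false , ¬g) (_ , g) = ¬g g
    ¬F∩G⇒¬F∪¬G : ∀ x → ¬ (F x × G x) → ∃ λ b → complement b x
    ¬F∩G⇒¬F∪¬G x ¬fg with em {F x}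
    ... | yes f = false , λ g → ¬fg (f , g)
    ... | no ¬f = true , ¬f

  Open⇒Closed-∁ : ∀ {U : X → Set} → Open U → Closed τ (λ x → ¬ U x)
  Open⇒Closed-∁ = Open-resp (λ x → mk⇔ (λ u ¬u → ¬u u) ¬¬-elim)

  Open⇒LocallyClosed : ∀ {U : X → Set} → Open U → LocallyClosed τ U
  Open⇒LocallyClosed {U} oU = U , (λ _ → ⊤) , oU , Closed-univ , λ x → mk⇔ (λ u → u , tt) proj₁

  Closed⇒LocallyClosed : ∀ {F : X → Set} → Closed τ F → LocallyClosed τ F
  Closed⇒LocallyClosed {F} cF = (λ _ → X) , F , Open-univ , cF , λ x → mk⇔ (λ f → x , f) proj₂

  LocallyClosed-∩ : ∀ {D E : X → Set} → LocallyClosed τ D → LocallyClosed τ E →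
    LocallyClosed τ (λ x → D x × E x)
  LocallyClosed-∩ (U , F , oU , cF , D⇔) (V , G , oV , cG , E⇔) =
    (λ x → U x × V x) , (λ x → F x × G x) , Open-∩ oU oV , Closed-∩ cF cG ,
    λ x → mk⇔
      (λ (d , e) → let (u , f) = to (D⇔ x) d ; (v , g) = to (E⇔ x) e in (u , v) , (f , g))
      (λ ((u , v) , (f , g)) → from (D⇔ x) (u , f) , from (E⇔ x) (v , g))

  ∁-part : ∀ {D : X → Set} → LocallyClosed τ D → Bool → X → Set
  ∁-part (U , F , _) false x = ¬ F x
  ∁-part (U , F , _) true  x = F x × ¬ U x

  ∁-part-locallyClosed : ∀ {D : X → Set} (lc : LocallyClosed τ D) b → LocallyClosed τ (∁-part lc b)
  ∁-part-locallyClosed (U , F , oU , cF , _) false = Open⇒LocallyClosed cF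
  ∁-part-locallyClosed (U , F , oU , cF , _) true  =
    Closed⇒LocallyClosed (Closed-∩ cF (Open⇒Closed-∁ oU))

  ∁-part-disjoint : ∀ {D : X → Set} (lc : LocallyClosed τ D) b x → ∁-part lc b x → D x → ⊥
  ∁-part-disjoint (U , F , _ , _ , D⇔) false x ¬f     d = ¬f (proj₂ (to (D⇔ x) d))
  ∁-part-disjoint (U , F , _ , _ , D⇔) true  x (_ , ¬u) d = ¬u (proj₁ (to (D⇔ x) d))

  ∁-parts-disjoint : ∀ {D : X → Set} (lc : LocallyClosed τ D) x →
    ∁-part lc true x → ∁-part lc false x → ⊥
  ∁-parts-disjoint (U , F , _) x (f , _) ¬f = ¬f f

  ∁-parts-cover : ∀ {D : X → Set} (lc : LocallyClosed τ D) x → D x ⊎ ∃ λ b → ∁-part lc b x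
  ∁-parts-cover (U , F , _ , _ , D⇔) x with em {F x} | em {U x}
  ... | no ¬f | _     = inj₂ (false , ¬f)
  ... | yes f | yes u = inj₁ (from (D⇔ x) (u , f))
  ... | yes f | no ¬u = inj₂ (true , f , ¬u)

proposition3 : ExcludedMiddle 0ℓ →
    (X : Set) (τ : Topology X) (A : X → Set) →
    ωConstructible τ A → DisjointUnionOfLocallyClosed τ A
proposition3 em X τ A (B , lcB , A⇔⋃B) =
  Piece 0 ∘ fromℕ ,
  (λ m → Piece-closure (LocallyClosed τ) LocallyClosed-∩ lcB
           (∁-part-locallyClosed ∘ lcB) 0 (fromℕ m)) ,
  (λ m n m≢n → Piece-disjoint (∁-part-disjoint ∘ lcB) (∁-parts-disjoint ∘ lcB)
                 0 (m≢n ∘ fromℕ-injective)) ,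
  λ x → trans (A⇔⋃B x) (⋃B⇔⋃Piece (∁-parts-cover ∘ lcB) x)
  where
  open Topological em τ
  open Disjointification B (∁-part ∘ lcB)
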